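{- Let $r\ge 3$, $n\geq 2k$, and let $\mathcal{H}\subset\binom{[2,n]}{k}$ be an intersecting family with $\tau(\mathcal{H})=r-1$. Define \[ \mathcal{F}_{\mathcal{H}}=\mathcal{H}\cup\Big\{F\in\binom{[n]}{k}: 1\in F,\ \exists\, T\in\mathcal{T}(\mathcal{H}) \text{ with } T\subset F\Big\}. \] If $\tau\big(\mathcal{T}(\mathcal{H})\setminus\mathcal{T}^{(k)}(\mathcal{H})\big)\geq r$, then $\tau(\mathcal{F}_{\mathcal{H}})=r$.
   Context: $[a,b]=\{i: a\le i\le b\}$. A family is intersecting if any two members intersect. A set $T$ is a cover of a family $\mathcal{F}$ if it meets every member; $\tau(\mathcal{F})$ is the minimum size of a cover. $\mathcal{T}(\mathcal{H})=\{T\subset[n]: |T|\le k,\ T\text{ is a cover of }\mathcal{H}\}$ and $\mathcal{T}^{(\ell)}(\mathcal{H})=\mathcal{T}(\mathcal{H})\cap\binom{[n]}{\ell}$. -}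

module Defs where

open import Data.Nat using (ℕ; _≤_)
open import Data.Fin using (Fin)
open import Data.Fin.Subset using (Subset; _∈_; _∉_; _⊆_; _∩_; ∣_∣; Nonempty)
open import Data.Product using (Σ; _×_; ∃)
open import Data.Sum using (_⊎_)
open import Relation.Binary.PropositionalEquality using (_≡_; _≢_)
open import Level using (0ℓ; suc)

-- Ground set [n] = {1,…,n} is modelled by Fin n; the element i ∈ [n]
-- corresponds to the index i-1.  In particular "1" is Fin.zero.

Family : ℕ → Set₁
Family n = Subset n → Set

Meets : ∀ {n} → Subset n → Subset n → Set
Meets A B = Nonempty (A ∩ B)

Intersecting : ∀ {n} → Family n → Set
Intersecting 𝓕 = ∀ A B → 𝓕 A → 𝓕 B → Meets A B

IsCover : ∀ {n} → Subset n → Family n → Set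
IsCover T 𝓕 = ∀ F → 𝓕 F → Meets T F

τ≥ : ∀ {n} → Family n → ℕ → Set
τ≥ 𝓕 r = ∀ T → IsCover T 𝓕 → r ≤ ∣ T ∣

τ≡ : ∀ {n} → Family n → ℕ → Set
τ≡ 𝓕 r = (Σ (Subset _) λ T → IsCover T 𝓕 × ∣ T ∣ ≡ r) × τ≥ 𝓕 r

𝒯 : ∀ {n} → ℕ → Family n → Family n
𝒯 k H T = ∣ T ∣ ≤ k × IsCover T H

𝒯-minus-𝒯k : ∀ {n} → ℕ → Family n → Family n
𝒯-minus-𝒯k k H T = 𝒯 k H T × ∣ T ∣ ≢ k

InBinom2n : ∀ {n} → ℕ → Family (Data.Nat.suc n) → Set
InBinom2n k H = ∀ F → H F → ∣ F ∣ ≡ k × Fin.zero ∉ F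
  where import Data.Fin as Fin

𝓕H : ∀ {n} → ℕ → Family (Data.Nat.suc n) → Family (Data.Nat.suc n)
𝓕H k H F = H F ⊎ (∣ F ∣ ≡ k × Data.Fin.zero ∈ F × (Σ (Subset _) λ T → 𝒯 k H T × T ⊆ F))

-- A minimum cover T of H avoids the point 1, which lies in no member of H;
-- then T ∪ {1} covers 𝓕_H, so τ(𝓕_H) ≤ r.  Conversely a cover S of 𝓕_H with
-- |S| < r also avoids 1, since S covers H and τ(H) = r - 1.  If S missed some
-- T ∈ 𝒯(H) with |T| < k, then T ∪ {1} could be enlarged to a k-set F disjoint
-- from S (there is room because |S| ≤ r - 1 ≤ k and 2k ≤ n), and F ∈ 𝓕_H
-- would be missed by S.  So S covers 𝒯(H) ∖ 𝒯⁽ᵏ⁾(H), forcing |S| ≥ r.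
module Submission where

open import Defs
open import Data.Nat using (ℕ; zero; suc; _+_; _*_; _∸_; _≤_; _<_; z≤n; s≤s; s≤s⁻¹; _≤?_)
open import Data.Nat.Properties
open import Data.Fin using (Fin) renaming (zero to 0F; suc to sucF)
open import Data.Fin.Subset
open import Data.Fin.Subset.Properties
open import Data.Vec using ([]; _∷_; here; there; tail)
open import Data.Product using (Σ; _×_; _,_; proj₁; proj₂)
open import Data.Sum using (inj₁; inj₂)
open import Function using (id; _∘_)
open import Relation.Nullary using (¬_; yes; no; contradiction)
open import Relation.Binary.PropositionalEquality using (_≡_; refl; sym; subst; cong)

⊆-interpolate : ∀ {n} k {A B : Subset n} → A ⊆ B → ∣ A ∣ ≤ k → k ≤ ∣ B ∣ →
  Σ (Subset n) λ F → A ⊆ F × F ⊆ B × ∣ F ∣ ≡ k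
⊆-interpolate k {[]} {[]} _ _ k≤0 = [] , id , id , sym (n≤0⇒n≡0 k≤0)
⊆-interpolate k {inside ∷ A} {outside ∷ B} A⊆B _ _ with A⊆B here
... | ()
⊆-interpolate k {outside ∷ A} {outside ∷ B} A⊆B A≤k k≤B
  with F , A⊆F , F⊆B , ∣F∣≡k ← ⊆-interpolate k (drop-∷-⊆ A⊆B) A≤k k≤B
  = outside ∷ F , out⊆ A⊆F , out⊆ F⊆B , ∣F∣≡k
⊆-interpolate (suc k) {inside ∷ A} {inside ∷ B} A⊆B A≤k k≤B
  with F , A⊆F , F⊆B , ∣F∣≡k ← ⊆-interpolate k (drop-∷-⊆ A⊆B) (s≤s⁻¹ A≤k) (s≤s⁻¹ k≤B)
  = inside ∷ F , in⊆in A⊆F , in⊆in F⊆B , cong suc ∣F∣≡k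
⊆-interpolate k {outside ∷ A} {inside ∷ B} A⊆B A≤k k≤B with k ≤? ∣ B ∣
... | yes k≤B′
  with F , A⊆F , F⊆B , ∣F∣≡k ← ⊆-interpolate k (drop-∷-⊆ A⊆B) A≤k k≤B′
  = outside ∷ F , out⊆ A⊆F , out⊆ F⊆B , ∣F∣≡k
⊆-interpolate zero {outside ∷ A} {inside ∷ B} _ _ _ | no k≰B = contradiction z≤n k≰B
⊆-interpolate (suc k) {outside ∷ A} {inside ∷ B} A⊆B A≤k k≤B | no k≰B
  with F , A⊆F , F⊆B , ∣F∣≡k ←
    ⊆-interpolate k (drop-∷-⊆ A⊆B)
      (≤-trans (p⊆q⇒∣p∣≤∣q∣ (drop-∷-⊆ A⊆B)) (s≤s⁻¹ (≰⇒> k≰B))) (s≤s⁻¹ k≤B)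
  = inside ∷ F , out⊆ A⊆F , in⊆in F⊆B , cong suc ∣F∣≡k

insert₀ : ∀ {n} → Subset (suc n) → Subset (suc n)
insert₀ p = inside ∷ tail p

p⊆insert₀p : ∀ {n} (p : Subset (suc n)) → p ⊆ insert₀ p
p⊆insert₀p (_ ∷ _) {0F} _ = here
p⊆insert₀p (_ ∷ _) {sucF _} (there x∈p) = there x∈p

insert₀-least : ∀ {n} {p q : Subset (suc n)} → 0F ∈ q → p ⊆ q → insert₀ p ⊆ q
insert₀-least 0∈q p⊆q {0F} _ = 0∈q
insert₀-least {p = _ ∷ _} 0∈q p⊆q {sucF _} (there x∈p) = p⊆q (there x∈p)

∣insert₀p∣≤1+∣p∣ : ∀ {n} (p : Subset (suc n)) → ∣ insert₀ p ∣ ≤ suc ∣ p ∣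
∣insert₀p∣≤1+∣p∣ (s ∷ p) = s≤s (∣p∣≤∣x∷p∣ s p)

0∉p⇒∣insert₀p∣≡1+∣p∣ : ∀ {n} {p : Subset (suc n)} → 0F ∉ p → ∣ insert₀ p ∣ ≡ suc ∣ p ∣
0∉p⇒∣insert₀p∣≡1+∣p∣ {p = inside ∷ _} 0∉p = contradiction here 0∉p
0∉p⇒∣insert₀p∣≡1+∣p∣ {p = outside ∷ _} _ = refl

IsCover-⊆ : ∀ {n} {T T′ : Subset n} {𝓕 : Family n} → T ⊆ T′ → IsCover T 𝓕 → IsCover T′ 𝓕
IsCover-⊆ {T = T} T⊆T′ T-cov F F∈𝓕 with x , x∈T∩F ← T-cov F F∈𝓕
  with x∈T , x∈F ← x∈p∩q⁻ T F x∈T∩F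
  = x , x∈p∩q⁺ (T⊆T′ x∈T , x∈F)

IsCover-─unused : ∀ {n} {x : Fin n} {T : Subset n} {𝓕 : Family n} →
  (∀ F → 𝓕 F → x ∉ F) → IsCover T 𝓕 → IsCover (T - x) 𝓕
IsCover-─unused {T = T} x∉𝓕 T-cov F F∈𝓕 with y , y∈T∩F ← T-cov F F∈𝓕
  with y∈T , y∈F ← x∈p∩q⁻ T F y∈T∩F
  = y , x∈p∩q⁺ (x∈p∧x≢y⇒x∈p-y y∈T (λ { refl → x∉𝓕 F F∈𝓕 y∈F }) , y∈F)

unused∉small-cover : ∀ {n} {x : Fin n} {T : Subset n} {𝓕 : Family n} {s : ℕ} →
  (∀ F → 𝓕 F → x ∉ F) → τ≥ 𝓕 s → IsCover T 𝓕 → ∣ T ∣ ≤ s → x ∉ T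
unused∉small-cover {T = T} x∉𝓕 τ≥s T-cov ∣T∣≤s x∈T =
  <-irrefl refl (<-≤-trans (≤-<-trans (τ≥s (T - _) (IsCover-─unused x∉𝓕 T-cov))
                                      (x∈p⇒∣p-x∣<∣p∣ x∈T)) ∣T∣≤s)

-- Constructively H may not be known to be nonempty; but were τ > k, every
-- member of H (a cover of size k) would be absurd, so ⊥ would cover H.
intersecting-τ≤uniformity : ∀ {n} {𝓕 : Family n} {k t : ℕ} → Intersecting 𝓕 →
  (∀ F → 𝓕 F → ∣ F ∣ ≡ k) → τ≥ 𝓕 (suc t) → suc t ≤ k
intersecting-τ≤uniformity {n} {𝓕} {k} {t} inter uniform τ≥ with suc t ≤? k
... | yes τ≤k = τ≤k
... | no τ≰k = contradiction (subst (suc t ≤_) (∣⊥∣≡0 n) (τ≥ ⊥ ⊥-covers)) λ ()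
  where
  ⊥-covers : IsCover ⊥ 𝓕
  ⊥-covers F F∈𝓕 = contradiction
    (subst (suc t ≤_) (uniform F F∈𝓕) (τ≥ F (λ G → inter F G F∈𝓕))) τ≰k

insert₀-extends-avoiding : ∀ {n k} {S T : Subset (suc n)} → k + ∣ S ∣ ≤ suc n →
  0F ∉ S → ¬ Meets S T → ∣ T ∣ < k →
  Σ (Subset (suc n)) λ F → insert₀ T ⊆ F × F ⊆ ∁ S × ∣ F ∣ ≡ k
insert₀-extends-avoiding {k = k} {S} {T} room 0∉S S-misses-T ∣T∣<k =
  ⊆-interpolate k T₀⊆∁S ∣T₀∣≤k k≤∣∁S∣
  where
  T₀ = insert₀ T

  T₀⊆∁S : T₀ ⊆ ∁ S
  T₀⊆∁S = insert₀-least (x∉p⇒x∈∁p 0∉S)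
    λ {x} x∈T → x∉p⇒x∈∁p λ x∈S → S-misses-T (x , x∈p∩q⁺ (x∈S , x∈T))

  ∣T₀∣≤k : ∣ T₀ ∣ ≤ k
  ∣T₀∣≤k = ≤-trans (∣insert₀p∣≤1+∣p∣ T) ∣T∣<k

  k≤∣∁S∣ : k ≤ ∣ ∁ S ∣
  k≤∣∁S∣ = subst (k ≤_) (sym (∣∁p∣≡n∸∣p∣ S)) (m+n≤o⇒m≤o∸n k room)

module _ {m k : ℕ} {H : Family (suc m)} (H⊆ : InBinom2n k H) where

  0∉H : ∀ F → H F → 0F ∉ F
  0∉H F F∈H = proj₂ (H⊆ F F∈H)

  insert₀-covers-𝓕H : ∀ {T} → IsCover T H → IsCover (insert₀ T) (𝓕H k H)
  insert₀-covers-𝓕H T-cov F (inj₁ F∈H) = IsCover-⊆ (p⊆insert₀p _) T-cov F F∈H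
  insert₀-covers-𝓕H T-cov F (inj₂ (_ , 0∈F , _)) = 0F , x∈p∩q⁺ (here , 0∈F)

  cover-of-𝓕H-covers-𝒯∖𝒯k : ∀ {S} → k + ∣ S ∣ ≤ suc m → IsCover S (𝓕H k H) → 0F ∉ S →
    IsCover S (𝒯-minus-𝒯k k H)
  cover-of-𝓕H-covers-𝒯∖𝒯k {S} room S-cov 0∉S T ((∣T∣≤k , T-cov) , ∣T∣≢k)
    with nonempty? (S ∩ T)
  ... | yes S-meets-T = S-meets-T
  ... | no S-misses-T
    with F , T₀⊆F , F⊆∁S , ∣F∣≡k ←
           insert₀-extends-avoiding room 0∉S S-misses-T (≤∧≢⇒< ∣T∣≤k ∣T∣≢k)
    with x , x∈S∩F ← S-cov F (inj₂ (∣F∣≡k , T₀⊆F here , T , (∣T∣≤k , T-cov) ,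
                                     T₀⊆F ∘ p⊆insert₀p T))
    with x∈S , x∈F ← x∈p∩q⁻ S F x∈S∩F
    = contradiction x∈S (x∈∁p⇒x∉p (F⊆∁S x∈F))

proposition1p6 : (m k r : ℕ) → 3 ≤ r → 2 * k ≤ suc m →
    (H : Family (suc m)) → InBinom2n k H → Intersecting H → τ≡ H (r ∸ 1) →
    τ≥ (𝒯-minus-𝒯k k H) r →
    τ≡ (𝓕H k H) r
proposition1p6 m k (suc (suc t)) (s≤s (s≤s _)) 2k≤n H H⊆ inter ((T , T-cov , ∣T∣≡r-1) , τH≥r-1) τ𝒯≥r =
  (insert₀ T , insert₀-covers-𝓕H H⊆ T-cov , ∣insert₀T∣≡r) , τ𝓕H≥r
  where
  ∣insert₀T∣≡r : ∣ insert₀ T ∣ ≡ suc (suc t)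
  ∣insert₀T∣≡r = subst (λ s → ∣ insert₀ T ∣ ≡ suc s) ∣T∣≡r-1
    (0∉p⇒∣insert₀p∣≡1+∣p∣ (unused∉small-cover (0∉H H⊆) τH≥r-1 T-cov (≤-reflexive ∣T∣≡r-1)))

  r-1≤k : suc t ≤ k
  r-1≤k = intersecting-τ≤uniformity inter (λ F → proj₁ ∘ H⊆ F) τH≥r-1

  small-cover-of-𝓕H-covers-𝒯∖𝒯k : ∀ {S} → IsCover S (𝓕H k H) → ∣ S ∣ ≤ suc t →
    IsCover S (𝒯-minus-𝒯k k H)
  small-cover-of-𝓕H-covers-𝒯∖𝒯k S-cov ∣S∣≤r-1 = cover-of-𝓕H-covers-𝒯∖𝒯k H⊆
    (≤-trans (+-monoʳ-≤ k (≤-trans ∣S∣≤r-1 r-1≤k))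
             (subst (_≤ suc m) (cong (k +_) (+-identityʳ k)) 2k≤n))
    S-cov
    (unused∉small-cover (0∉H H⊆) τH≥r-1 (λ F → S-cov F ∘ inj₁) ∣S∣≤r-1)

  τ𝓕H≥r : τ≥ (𝓕H k H) (suc (suc t))
  τ𝓕H≥r S S-cov = ≮⇒≥ λ ∣S∣<r →
    <⇒≱ ∣S∣<r (τ𝒯≥r S (small-cover-of-𝓕H-covers-𝒯∖𝒯k S-cov (s≤s⁻¹ ∣S∣<r)))
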